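{- Let $n,m$ be positive integers. Then \[\sum_{d=0}^{\min\{m,n\}}\{SF_d\}_{\lambda_1\le n+m-2d}+\sum_{d=0}^{\min\{m,n\}-1}\{SF_d\}_{\lambda_1\le n+m-2d-1}=\sum_{r=0}^{\min\{m,n\}}SF_r.\]
   Context: $\Lambda$ is the ring of symmetric functions over $\mathbb{C}(q)$, $s_\mu$ Schur functions, $h_k$ complete homogeneous symmetric functions. For $0\le d\le\min\{m,n\}$, $SF_d=\sum_{\mu\vdash d}(s_\mu h_{n-d})\otimes(s_\mu h_{m-d})\in\Lambda\otimes_{\mathbb{C}(q)}\Lambda$. For $F=\sum c_{\lambda,\mu}s_\lambda\otimes s_\mu$ and an integer $L$, $\{F\}_{\lambda_1\le L}=\sum c_{\lambda,\mu}s_\lambda\otimes s_\mu$ summed only over pairs with both $\lambda_1\le L$ and $\mu_1\le L$. -}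

module Defs where

open import Data.Nat using (ℕ; zero; suc; _+_; _*_; _∸_; _≤ᵇ_; _≡ᵇ_)
open import Data.Bool using (Bool; true; false; _∧_; if_then_else_)
open import Data.List using (List; []; _∷_; map; concatMap; _++_)
open import Data.Nat.ListAction using (sum)

-- Partitions, represented as lists of positive, weakly decreasing parts.

head0 : List ℕ → ℕ
head0 []      = 0
head0 (x ∷ _) = x

tail0 : List ℕ → List ℕ
tail0 []       = []
tail0 (_ ∷ xs) = xs

isPartition : List ℕ → Bool
isPartition []       = true
isPartition (x ∷ xs) = (1 ≤ᵇ x) ∧ (head0 xs ≤ᵇ x) ∧ isPartition xs

size : List ℕ → ℕ
size = sum

-- all partitions of n with largest part ≤ k (fuel f ≥ n)
partsLE : (fuel n k : ℕ) → List (List ℕ)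
partsLE _        zero    _ = [] ∷ []
partsLE zero     (suc _) _ = []
partsLE (suc f) (suc n) k = concatMap (λ j → map (j ∷_) (partsLE f (suc n ∸ j) j)) (range1 (minℕ k (suc n)))
  where
  minℕ : ℕ → ℕ → ℕ
  minℕ zero    _       = zero
  minℕ (suc a) zero    = zero
  minℕ (suc a) (suc b) = suc (minℕ a b)
  range1 : ℕ → List ℕ
  range1 zero    = []
  range1 (suc t) = range1 t ++ (suc t ∷ [])

partitions : ℕ → List (List ℕ)
partitions d = partsLE d d d

-- λ/μ is a horizontal strip: λ₁ ≥ μ₁ ≥ λ₂ ≥ μ₂ ≥ … (parts padded by 0).

hstrip : List ℕ → List ℕ → Bool
hstrip []       []      = true
hstrip []       (_ ∷ _) = false
hstrip (l ∷ ls) μ       = (head0 μ ≤ᵇ l) ∧ (head0 ls ≤ᵇ head0 μ) ∧ hstrip ls (tail0 μ)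

-- Elements of Λ ⊗ Λ, given by their coefficients in the basis s_λ ⊗ s_ν.
-- (Only entries indexed by pairs of partitions are meaningful.)

Λ⊗Λ : Set
Λ⊗Λ = List ℕ → List ℕ → ℕ

_⊕_ : Λ⊗Λ → Λ⊗Λ → Λ⊗Λ
(F ⊕ G) λ' ν = F λ' ν + G λ' ν

zeroΛ : Λ⊗Λ
zeroΛ _ _ = 0

sumTo : ℕ → (ℕ → Λ⊗Λ) → Λ⊗Λ
sumTo zero    F = F 0
sumTo (suc N) F = sumTo N F ⊕ F (suc N)

-- Coefficient of s_λ in s_μ h_k (Pieri rule): 1 iff λ is a partition,
-- |λ| = |μ| + k and λ/μ is a horizontal strip.
pieri : (μ : List ℕ) (k : ℕ) (λ' : List ℕ) → ℕ
pieri μ k λ' =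
  if isPartition λ' ∧ (size λ' ≡ᵇ size μ + k) ∧ hstrip λ' μ then 1 else 0

-- SF_d = Σ_{μ ⊢ d} (s_μ h_{n-d}) ⊗ (s_μ h_{m-d})
SF : (n m d : ℕ) → Λ⊗Λ
SF n m d λ' ν = sum (map (λ μ → pieri μ (n ∸ d) λ' * pieri μ (m ∸ d) ν) (partitions d))

trunc : ℕ → Λ⊗Λ → Λ⊗Λ
trunc L F λ' ν = if (head0 λ' ≤ᵇ L) ∧ (head0 ν ≤ᵇ L) then F λ' ν else 0

-- For partitions λ ⊢ n and ν ⊢ m, the Pieri rule makes the coefficient of s_λ ⊗ s_ν in SF_d
-- the number of μ ⊢ d such that λ/μ and ν/μ are horizontal strips, i.e. of choices
-- μᵢ ∈ [max(λᵢ₊₁, νᵢ₊₁), min(λᵢ, νᵢ)] with Σ μᵢ = d.  These numbers are the coefficients of a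
-- product of q-integers, hence palindromic of degree K = n + m − max(λ₁, ν₁), and they vanish
-- for d > min(n, m).  The truncations max(λ₁, ν₁) ≤ n + m − 2d and ≤ n + m − 2d − 1 become
-- 2d ≤ K and 2d + 1 ≤ K; reflecting d ↦ K − d in the second sum turns the latter into 2d > K,
-- so every coefficient is counted exactly once.

module Submission where

open import Defs
open import Data.Nat using (ℕ; zero; suc; _+_; _*_; _∸_; _≤_; _<_; _⊓_; _⊔_; _≤ᵇ_; _≡ᵇ_; z≤n; s≤s; _≤?_)
open import Data.Nat.Properties
open import Data.Nat.Solver using (module +-*-Solver)
open import Data.Nat.ListAction using (sum)
open import Data.Nat.ListAction.Properties using (sum-++)
open import Data.Bool using (Bool; true; false; _∧_; if_then_else_; T)
open import Data.Bool.Properties using (T-∧; ∧-assoc; T?)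
open import Data.List using (List; []; _∷_; map; concat; concatMap; _++_; _∷ʳ_)
open import Data.List.Properties using (map-++; map-∘; map-cong; map-cong-local; map-concatMap)
open import Data.List.Relation.Unary.All as All using (All; []; _∷_)
open import Data.List.Relation.Unary.All.Properties using (map⁺; concat⁺; ∷ʳ⁺)
open import Data.Product using (_×_; _,_; proj₁; proj₂)
open import Data.Sum using (inj₁; inj₂)
open import Data.Empty using (⊥-elim)
open import Data.Unit using (tt)
open import Function.Bundles using (Equivalence)
open import Relation.Nullary using (Dec; yes; no; ¬_)
open import Relation.Binary.PropositionalEquality
  using (_≡_; refl; sym; trans; cong; cong₂; subst; module ≡-Reasoning)
open import Algebra.Properties.CommutativeSemigroup +-commutativeSemigroup using ()
  renaming (interchange to +-interchange)
open import Algebra.Properties.CommutativeSemigroup *-commutativeSemigroup using ()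
  renaming (interchange to *-interchange)

open Equivalence using (to; from)
open +-*-Solver using (solve; _:+_; _:*_; _:=_)

𝟙 : Bool → ℕ
𝟙 b = if b then 1 else 0

[_≤_] : ℕ → ℕ → ℕ
[ a ≤ b ] = 𝟙 (a ≤ᵇ b)

⟦_≤_≤_⟧ : ℕ → ℕ → ℕ → ℕ
⟦ a ≤ x ≤ b ⟧ = [ a ≤ x ] * [ x ≤ b ]

if-then-0≡𝟙* : ∀ b x → (if b then x else 0) ≡ 𝟙 b * x
if-then-0≡𝟙* false x = refl
if-then-0≡𝟙* true  x = sym (+-identityʳ x)

𝟙-∧ : ∀ x y → 𝟙 (x ∧ y) ≡ 𝟙 x * 𝟙 y
𝟙-∧ false y = refl
𝟙-∧ true  y = sym (+-identityʳ (𝟙 y))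

𝟙-T : ∀ {b} → T b → 𝟙 b ≡ 1
𝟙-T {true} _ = refl

𝟙-¬T : ∀ {b} → ¬ T b → 𝟙 b ≡ 0
𝟙-¬T {false} _  = refl
𝟙-¬T {true}  ¬b = ⊥-elim (¬b tt)

𝟙-cong : ∀ {x y} → (T x → T y) → (T y → T x) → 𝟙 x ≡ 𝟙 y
𝟙-cong {false} {false} _   _   = refl
𝟙-cong {false} {true}  _   y⇒x = ⊥-elim (y⇒x tt)
𝟙-cong {true}  {false} x⇒y _   = ⊥-elim (x⇒y tt)
𝟙-cong {true}  {true}  _   _   = refl

𝟙-guard : ∀ b {x y} → (T b → x ≡ y) → 𝟙 b * x ≡ 𝟙 b * y
𝟙-guard false _   = refl
𝟙-guard true  x≡y = cong (_+ 0) (x≡y tt)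

module _ {a b : ℕ} where

  [≤]-yes : a ≤ b → [ a ≤ b ] ≡ 1
  [≤]-yes a≤b = 𝟙-T (≤⇒≤ᵇ a≤b)

  [≤]-no : b < a → [ a ≤ b ] ≡ 0
  [≤]-no b<a = 𝟙-¬T (λ a≤b → <⇒≱ b<a (≤ᵇ⇒≤ a b a≤b))

  [≤]-cong : ∀ {c d} → (a ≤ b → c ≤ d) → (c ≤ d → a ≤ b) → [ a ≤ b ] ≡ [ c ≤ d ]
  [≤]-cong {c} {d} ⇒ ⇐ = 𝟙-cong (λ p → ≤⇒≤ᵇ (⇒ (≤ᵇ⇒≤ a b p))) (λ p → ≤⇒≤ᵇ (⇐ (≤ᵇ⇒≤ c d p)))

  [≤]-guard : ∀ {x y} → (a ≤ b → x ≡ y) → [ a ≤ b ] * x ≡ [ a ≤ b ] * y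
  [≤]-guard x≡y = 𝟙-guard (a ≤ᵇ b) (λ p → x≡y (≤ᵇ⇒≤ a b p))

  [≤]-null : ∀ {x} → (a ≤ b → x ≡ 0) → [ a ≤ b ] * x ≡ 0
  [≤]-null {x} x≡0 = trans ([≤]-guard x≡0) (*-zeroʳ [ a ≤ b ])

module _ {a x b : ℕ} where

  ⟦≤≤⟧-guard : ∀ {y z} → (a ≤ x → x ≤ b → y ≡ z) → ⟦ a ≤ x ≤ b ⟧ * y ≡ ⟦ a ≤ x ≤ b ⟧ * z
  ⟦≤≤⟧-guard {y} {z} y≡z = begin
    [ a ≤ x ] * [ x ≤ b ] * y    ≡⟨ *-assoc [ a ≤ x ] _ y ⟩
    [ a ≤ x ] * ([ x ≤ b ] * y)  ≡⟨ [≤]-guard (λ a≤x → [≤]-guard (y≡z a≤x)) ⟩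
    [ a ≤ x ] * ([ x ≤ b ] * z)  ≡⟨ *-assoc [ a ≤ x ] _ z ⟨
    [ a ≤ x ] * [ x ≤ b ] * z    ∎
    where open ≡-Reasoning

  ⟦≤≤⟧-null : ∀ {y} → (a ≤ x → x ≤ b → y ≡ 0) → ⟦ a ≤ x ≤ b ⟧ * y ≡ 0
  ⟦≤≤⟧-null {y} y≡0 = trans (⟦≤≤⟧-guard y≡0) (*-zeroʳ ⟦ a ≤ x ≤ b ⟧)

[m⊔n≤o]≡[m≤o]*[n≤o] : ∀ m n o → [ m ⊔ n ≤ o ] ≡ [ m ≤ o ] * [ n ≤ o ]
[m⊔n≤o]≡[m≤o]*[n≤o] m n o = trans (𝟙-cong ⇒ ⇐) (𝟙-∧ (m ≤ᵇ o) (n ≤ᵇ o))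
  where
  ⇒ : T (m ⊔ n ≤ᵇ o) → T ((m ≤ᵇ o) ∧ (n ≤ᵇ o))
  ⇒ p = let m⊔n≤o = ≤ᵇ⇒≤ (m ⊔ n) o p in
        from T-∧ (≤⇒≤ᵇ (m⊔n≤o⇒m≤o m n m⊔n≤o) , ≤⇒≤ᵇ (m⊔n≤o⇒n≤o m n m⊔n≤o))
  ⇐ : T ((m ≤ᵇ o) ∧ (n ≤ᵇ o)) → T (m ⊔ n ≤ᵇ o)
  ⇐ p = let (m≤o , n≤o) = to T-∧ p in ≤⇒≤ᵇ (⊔-lub (≤ᵇ⇒≤ m o m≤o) (≤ᵇ⇒≤ n o n≤o))

[m≤n⊓o]≡[m≤n]*[m≤o] : ∀ m n o → [ m ≤ n ⊓ o ] ≡ [ m ≤ n ] * [ m ≤ o ]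
[m≤n⊓o]≡[m≤n]*[m≤o] m n o = trans (𝟙-cong ⇒ ⇐) (𝟙-∧ (m ≤ᵇ n) (m ≤ᵇ o))
  where
  ⇒ : T (m ≤ᵇ n ⊓ o) → T ((m ≤ᵇ n) ∧ (m ≤ᵇ o))
  ⇒ p = let m≤n⊓o = ≤ᵇ⇒≤ m (n ⊓ o) p in
        from T-∧ (≤⇒≤ᵇ (m≤n⊓o⇒m≤n n o m≤n⊓o) , ≤⇒≤ᵇ (m≤n⊓o⇒m≤o n o m≤n⊓o))
  ⇐ : T ((m ≤ᵇ n) ∧ (m ≤ᵇ o)) → T (m ≤ᵇ n ⊓ o)
  ⇐ p = let (m≤n , m≤o) = to T-∧ p in ≤⇒≤ᵇ (⊓-glb (≤ᵇ⇒≤ m n m≤n) (≤ᵇ⇒≤ m o m≤o))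

m⊓n+m⊔n≡m+n : ∀ m n → (m ⊓ n) + (m ⊔ n) ≡ m + n
m⊓n+m⊔n≡m+n zero    n       = refl
m⊓n+m⊔n≡m+n (suc m) zero    = sym (+-identityʳ (suc m))
m⊓n+m⊔n≡m+n (suc m) (suc n) = cong suc (begin
  m ⊓ n + suc (m ⊔ n)     ≡⟨ +-suc (m ⊓ n) (m ⊔ n) ⟩
  suc (m ⊓ n + (m ⊔ n))   ≡⟨ cong suc (m⊓n+m⊔n≡m+n m n) ⟩
  suc (m + n)             ≡⟨ +-suc m n ⟨
  m + suc n               ∎)
  where open ≡-Reasoning

Σ≤ : ℕ → (ℕ → ℕ) → ℕ
Σ≤ zero    g = g 0
Σ≤ (suc R) g = Σ≤ R g + g (suc R)

VanishesAbove : ℕ → (ℕ → ℕ) → Set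
VanishesAbove R g = ∀ d → R < d → g d ≡ 0

VanishesAbove-mono : ∀ {R R′ g} → R ≤ R′ → VanishesAbove R g → VanishesAbove R′ g
VanishesAbove-mono R≤R′ g≡0 d R′<d = g≡0 d (≤-<-trans R≤R′ R′<d)

Σ≤-cong : ∀ R {g h : ℕ → ℕ} → (∀ d → d ≤ R → g d ≡ h d) → Σ≤ R g ≡ Σ≤ R h
Σ≤-cong zero    g≡h = g≡h 0 z≤n
Σ≤-cong (suc R) g≡h = cong₂ _+_ (Σ≤-cong R (λ d d≤R → g≡h d (m≤n⇒m≤1+n d≤R))) (g≡h (suc R) ≤-refl)

Σ≤-zero : ∀ R {g : ℕ → ℕ} → (∀ d → d ≤ R → g d ≡ 0) → Σ≤ R g ≡ 0
Σ≤-zero zero    g≡0 = g≡0 0 z≤n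
Σ≤-zero (suc R) g≡0 = cong₂ _+_ (Σ≤-zero R (λ d d≤R → g≡0 d (m≤n⇒m≤1+n d≤R))) (g≡0 (suc R) ≤-refl)

Σ≤-distrib-+ : ∀ R (g h : ℕ → ℕ) → Σ≤ R (λ d → g d + h d) ≡ Σ≤ R g + Σ≤ R h
Σ≤-distrib-+ zero    g h = refl
Σ≤-distrib-+ (suc R) g h = trans (cong (_+ (g (suc R) + h (suc R))) (Σ≤-distrib-+ R g h))
                                 (+-interchange (Σ≤ R g) (Σ≤ R h) (g (suc R)) (h (suc R)))

Σ≤-extend : ∀ {R R′} (g : ℕ → ℕ) → R ≤ R′ → VanishesAbove R g → Σ≤ R′ g ≡ Σ≤ R g
Σ≤-extend {R′ = zero}   g z≤n  _   = refl
Σ≤-extend {R′ = suc R′} g R≤R′ g≡0 with m≤n⇒m<n∨m≡n R≤R′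
... | inj₂ refl         = refl
... | inj₁ (s≤s R≤R′₋₁) =
  trans (cong₂ _+_ (Σ≤-extend g R≤R′₋₁ g≡0) (g≡0 (suc R′) (s≤s R≤R′₋₁))) (+-identityʳ _)

Σ≤-support : ∀ {R R′} (g : ℕ → ℕ) → VanishesAbove R g → VanishesAbove R′ g → Σ≤ R g ≡ Σ≤ R′ g
Σ≤-support {R} {R′} g g≡0 g≡0′ with ≤-total R R′
... | inj₁ R≤R′ = sym (Σ≤-extend g R≤R′ g≡0)
... | inj₂ R′≤R = Σ≤-extend g R′≤R g≡0′

Σ≤-unconsˡ : ∀ R (g : ℕ → ℕ) → Σ≤ (suc R) g ≡ g 0 + Σ≤ R (λ d → g (suc d))
Σ≤-unconsˡ zero    g = refl
Σ≤-unconsˡ (suc R) g = trans (cong (_+ g (suc (suc R))) (Σ≤-unconsˡ R g)) (+-assoc (g 0) _ _)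

Σ≤-reverse : ∀ R (g : ℕ → ℕ) → Σ≤ R g ≡ Σ≤ R (λ d → g (R ∸ d))
Σ≤-reverse zero    g = refl
Σ≤-reverse (suc R) g = begin
  Σ≤ (suc R) g                         ≡⟨ Σ≤-unconsˡ R g ⟩
  g 0 + Σ≤ R (λ d → g (suc d))         ≡⟨ cong (g 0 +_) (Σ≤-reverse R (λ d → g (suc d))) ⟩
  g 0 + Σ≤ R (λ d → g (suc (R ∸ d)))   ≡⟨ cong (g 0 +_) (Σ≤-cong R λ d d≤R → cong g (+-∸-assoc 1 d≤R)) ⟨
  g 0 + Σ≤ R (λ d → g (suc R ∸ d))     ≡⟨ +-comm (g 0) _ ⟩
  Σ≤ R (λ d → g (suc R ∸ d)) + g 0     ≡⟨ cong (λ z → Σ≤ R (λ d → g (suc R ∸ d)) + g z) (n∸n≡0 R) ⟨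
  Σ≤ (suc R) (λ d → g (suc R ∸ d))     ∎
  where open ≡-Reasoning

sumTo-apply : ∀ N (F : ℕ → Λ⊗Λ) λ′ ν → sumTo N F λ′ ν ≡ Σ≤ N (λ d → F d λ′ ν)
sumTo-apply zero    F λ′ ν = refl
sumTo-apply (suc N) F λ′ ν = cong (_+ F (suc N) λ′ ν) (sumTo-apply N F λ′ ν)

sum-concat : ∀ (xss : List (List ℕ)) → sum (concat xss) ≡ sum (map sum xss)
sum-concat []         = refl
sum-concat (xs ∷ xss) = trans (sum-++ xs (concat xss)) (cong (sum xs +_) (sum-concat xss))

sum-map-concatMap : ∀ {A B : Set} (g : B → ℕ) (h : A → List B) xs →
  sum (map g (concatMap h xs)) ≡ sum (map (λ x → sum (map g (h x))) xs)
sum-map-concatMap g h xs = begin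
  sum (map g (concatMap h xs))                ≡⟨ cong sum (map-concatMap g h xs) ⟩
  sum (concat (map (λ x → map g (h x)) xs))   ≡⟨ sum-concat (map (λ x → map g (h x)) xs) ⟩
  sum (map sum (map (λ x → map g (h x)) xs))  ≡⟨ cong sum (map-∘ xs) ⟨
  sum (map (λ x → sum (map g (h x))) xs)      ∎
  where open ≡-Reasoning

sum-map-*ˡ : ∀ {A : Set} c (g : A → ℕ) xs → sum (map (λ x → c * g x) xs) ≡ c * sum (map g xs)
sum-map-*ˡ c g []       = sym (*-zeroʳ c)
sum-map-*ˡ c g (x ∷ xs) = trans (cong (c * g x +_) (sum-map-*ˡ c g xs)) (sym (*-distribˡ-+ c (g x) _))

-- Palindromic sequences

Palindromic : ℕ → (ℕ → ℕ) → Set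
Palindromic K f = ∀ d e → d + e ≡ K → f d ≡ f e

VanishesAbove-*ˡ : ∀ {R f} (c : ℕ → ℕ) → VanishesAbove R f → VanishesAbove R (λ d → c d * f d)
VanishesAbove-*ˡ c f≡0 d R<d = trans (cong (c d *_) (f≡0 d R<d)) (*-zeroʳ (c d))

[≤]-halves : ∀ d e → [ 2 * d ≤ d + e ] + [ suc (2 * e) ≤ d + e ] ≡ 1
[≤]-halves d e with d ≤? e
... | yes d≤e = cong₂ _+_
  ([≤]-yes (+-monoʳ-≤ d (subst (_≤ e) (sym (+-identityʳ d)) d≤e)))
  ([≤]-no (s≤s (subst (d + e ≤_) (cong (e +_) (sym (+-identityʳ e))) (+-monoˡ-≤ e d≤e))))
... | no  d≰e = cong₂ _+_
  ([≤]-no (+-monoʳ-< d (subst (e <_) (sym (+-identityʳ d)) (≰⇒> d≰e))))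
  ([≤]-yes (subst (_≤ d + e) (cong (λ z → suc (e + z)) (sym (+-identityʳ e))) (+-monoˡ-≤ e (≰⇒> d≰e))))

-- Reflecting the second sum turns [ 2d + 1 ≤ K ] into [ K < 2d ], the complement of [ 2d ≤ K ].
Σ≤-palindromic-halves : ∀ {K f} → Palindromic K f →
  Σ≤ K (λ d → [ 2 * d ≤ K ] * f d) + Σ≤ K (λ d → [ suc (2 * d) ≤ K ] * f d) ≡ Σ≤ K f
Σ≤-palindromic-halves {K} {f} f-pal = begin
  Σ≤ K even + Σ≤ K odd            ≡⟨ cong (Σ≤ K even +_) (trans (Σ≤-reverse K odd) (Σ≤-cong K reflect)) ⟩
  Σ≤ K even + Σ≤ K oddᴿ           ≡⟨ Σ≤-distrib-+ K even oddᴿ ⟨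
  Σ≤ K (λ d → even d + oddᴿ d)    ≡⟨ Σ≤-cong K complementary ⟩
  Σ≤ K f                          ∎
  where
  open ≡-Reasoning
  even odd oddᴿ : ℕ → ℕ
  even d = [ 2 * d ≤ K ] * f d
  odd  d = [ suc (2 * d) ≤ K ] * f d
  oddᴿ d = [ suc (2 * (K ∸ d)) ≤ K ] * f d
  reflect : ∀ d → d ≤ K → odd (K ∸ d) ≡ oddᴿ d
  reflect d d≤K = cong ([ suc (2 * (K ∸ d)) ≤ K ] *_) (f-pal (K ∸ d) d (m∸n+n≡m d≤K))
  complementary : ∀ d → d ≤ K → even d + oddᴿ d ≡ f d
  complementary d d≤K = begin
    even d + oddᴿ d                                       ≡⟨ *-distribʳ-+ (f d) [ 2 * d ≤ K ] _ ⟨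
    ([ 2 * d ≤ K ] + [ suc (2 * (K ∸ d)) ≤ K ]) * f d     ≡⟨ cong (_* f d) halves ⟩
    1 * f d                                               ≡⟨ *-identityˡ (f d) ⟩
    f d                                                   ∎
    where
    halves : [ 2 * d ≤ K ] + [ suc (2 * (K ∸ d)) ≤ K ] ≡ 1
    halves = subst (λ K′ → [ 2 * d ≤ K′ ] + [ suc (2 * (K ∸ d)) ≤ K′ ] ≡ 1)
                   (m+[n∸m]≡n d≤K) ([≤]-halves d (K ∸ d))

-- The coefficient of s_λ ⊗ s_ν on the left-hand side, for s = n + m and M = max(λ₁, ν₁).
truncatedSum : (s M N : ℕ) → (ℕ → ℕ) → ℕ
truncatedSum s M N g =
  Σ≤ N (λ d → [ M ≤ s ∸ 2 * d ] * g d) + Σ≤ (N ∸ 1) (λ d → [ M ≤ s ∸ 2 * d ∸ 1 ] * g d)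

truncatedSum-cong : ∀ s M N {g h : ℕ → ℕ} → (∀ d → d ≤ N → g d ≡ h d) →
  truncatedSum s M N g ≡ truncatedSum s M N h
truncatedSum-cong s M N g≡h = cong₂ _+_
  (Σ≤-cong N λ d d≤N → cong ([ M ≤ s ∸ 2 * d ] *_) (g≡h d d≤N))
  (Σ≤-cong (N ∸ 1) λ d d≤N-1 → cong ([ M ≤ s ∸ 2 * d ∸ 1 ] *_) (g≡h d (≤-trans d≤N-1 (m∸n≤m N 1))))

truncatedSum-null : ∀ s M N {g : ℕ → ℕ} → (∀ d → d ≤ N → g d ≡ 0) → truncatedSum s M N g ≡ Σ≤ N g
truncatedSum-null s M N g≡0 = begin
  truncatedSum s M N _         ≡⟨ truncatedSum-cong s M N g≡0 ⟩
  truncatedSum s M N (λ _ → 0) ≡⟨ cong₂ _+_ (Σ≤-zero N λ d _ → *-zeroʳ [ M ≤ s ∸ 2 * d ])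
                                            (Σ≤-zero (N ∸ 1) λ d _ → *-zeroʳ [ M ≤ s ∸ 2 * d ∸ 1 ]) ⟩
  0                            ≡⟨ Σ≤-zero N g≡0 ⟨
  Σ≤ N _                       ∎
  where open ≡-Reasoning

[M≤K+M∸x]≡[x≤K] : ∀ {K M x} → x ≤ K + M → [ M ≤ K + M ∸ x ] ≡ [ x ≤ K ]
[M≤K+M∸x]≡[x≤K] {K} {M} {x} x≤K+M = [≤]-cong
  (λ M≤K+M∸x → +-cancelʳ-≤ M x K (subst (_≤ K + M) (+-comm M x) (m≤o∸n⇒m+n≤o M x≤K+M M≤K+M∸x)))
  (λ x≤K → m+n≤o⇒m≤o∸n M (subst (_≤ K + M) (+-comm x M) (+-monoˡ-≤ M x≤K)))

-- For N = 0 the second sum Σ≤ (N ∸ 1) would still contain the term d = 0; hence 1 ≤ N.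
truncatedSum-palindromic : ∀ {s M N K f} → 1 ≤ N → 2 * N ≤ s → K + M ≡ s →
  Palindromic K f → VanishesAbove N f → VanishesAbove K f → truncatedSum s M N f ≡ Σ≤ N f
truncatedSum-palindromic {M = M} {N} {K} {f} 1≤N 2N≤s refl f-pal f≡0ᴺ f≡0ᴷ = begin
  truncatedSum (K + M) M N f   ≡⟨ cong₂ _+_ (Σ≤-cong N even-term) (Σ≤-cong (N ∸ 1) odd-term) ⟩
  Σ≤ N even + Σ≤ (N ∸ 1) odd   ≡⟨ cong₂ _+_ (Σ≤-support even even≡0ᴺ even≡0ᴷ) (Σ≤-support odd odd≡0ᴺ odd≡0ᴷ) ⟩
  Σ≤ K even + Σ≤ K odd         ≡⟨ Σ≤-palindromic-halves f-pal ⟩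
  Σ≤ K f                       ≡⟨ Σ≤-support f f≡0ᴷ f≡0ᴺ ⟩
  Σ≤ N f                       ∎
  where
  open ≡-Reasoning
  even odd : ℕ → ℕ
  even d = [ 2 * d ≤ K ] * f d
  odd  d = [ suc (2 * d) ≤ K ] * f d
  1+[N∸1]≡N : suc (N ∸ 1) ≡ N
  1+[N∸1]≡N = m+[n∸m]≡n 1≤N
  even-term : ∀ d → d ≤ N → [ M ≤ K + M ∸ 2 * d ] * f d ≡ even d
  even-term d d≤N = cong (_* f d) ([M≤K+M∸x]≡[x≤K] (≤-trans (*-monoʳ-≤ 2 d≤N) 2N≤s))
  odd-term : ∀ d → d ≤ N ∸ 1 → [ M ≤ K + M ∸ 2 * d ∸ 1 ] * f d ≡ odd d
  odd-term d d≤N-1 = cong (_* f d) (trans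
    (cong [ M ≤_] (trans (∸-+-assoc (K + M) (2 * d) 1) (cong (K + M ∸_) (+-comm (2 * d) 1))))
    ([M≤K+M∸x]≡[x≤K] {K} {M} (≤-trans 1+2d≤2[1+d] (≤-trans (*-monoʳ-≤ 2 1+d≤N) 2N≤s))))
    where
    1+d≤N : suc d ≤ N
    1+d≤N = subst (suc d ≤_) 1+[N∸1]≡N (s≤s d≤N-1)
    1+2d≤2[1+d] : suc (2 * d) ≤ 2 * suc d
    1+2d≤2[1+d] = s≤s (+-monoʳ-≤ d (n≤1+n (d + 0)))
  even≡0ᴺ : VanishesAbove N even
  even≡0ᴺ = VanishesAbove-*ˡ (λ d → [ 2 * d ≤ K ]) f≡0ᴺ
  even≡0ᴷ : VanishesAbove K even
  even≡0ᴷ = VanishesAbove-*ˡ (λ d → [ 2 * d ≤ K ]) f≡0ᴷ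
  odd≡0ᴷ : VanishesAbove K odd
  odd≡0ᴷ = VanishesAbove-*ˡ (λ d → [ suc (2 * d) ≤ K ]) f≡0ᴷ
  -- When 2d < K the symmetry gives f d = f (K ∸ d), and K ∸ d > d ≥ N.
  odd≡0ᴺ : VanishesAbove (N ∸ 1) odd
  odd≡0ᴺ d N-1<d = [≤]-null {suc (2 * d)} {K} λ 1+2d≤K →
    let 1+d+d≤K = subst (λ z → suc (d + z) ≤ K) (+-identityʳ d) 1+2d≤K
        N≤d     = subst (_≤ d) 1+[N∸1]≡N N-1<d
    in trans (f-pal d (K ∸ d) (m+[n∸m]≡n (≤-trans (m≤m+n d d) (<⇒≤ 1+d+d≤K))))
             (f≡0ᴺ (K ∸ d) (≤-<-trans N≤d (m+n≤o⇒m≤o∸n (suc d) 1+d+d≤K)))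

-- Lattice points of a box with prescribed coordinate sum

shift : ℕ → (ℕ → ℕ) → ℕ → ℕ
shift x g d = [ x ≤ d ] * g (d ∸ x)

shift-vanishes : ∀ {K g} x → VanishesAbove K g → VanishesAbove (x + K) (shift x g)
shift-vanishes {K} x g≡0 d x+K<d = [≤]-null {x} {d} λ _ →
  g≡0 (d ∸ x) (m+n≤o⇒m≤o∸n (suc K) (subst (λ z → suc z ≤ d) (+-comm x K) x+K<d))

module _ {x y d e K : ℕ} (d+e≡x+y+K : d + e ≡ (x + y) + K) where

  ∸-balanced : x ≤ d → y ≤ e → (d ∸ x) + (e ∸ y) ≡ K
  ∸-balanced x≤d y≤e = +-cancelˡ-≡ (x + y) _ _ (begin
    (x + y) + ((d ∸ x) + (e ∸ y))      ≡⟨ +-interchange x y (d ∸ x) (e ∸ y) ⟩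
    (x + (d ∸ x)) + (y + (e ∸ y))      ≡⟨ cong₂ _+_ (m+[n∸m]≡n x≤d) (m+[n∸m]≡n y≤e) ⟩
    d + e                              ≡⟨ d+e≡x+y+K ⟩
    (x + y) + K                        ∎)
    where open ≡-Reasoning

  ∸-unbalanced : x ≤ d → e < y → K < d ∸ x
  ∸-unbalanced x≤d e<y = m+n≤o⇒m≤o∸n (suc K) (+-cancelʳ-< y (K + x) d (begin-strict
    K + x + y    ≡⟨ +-assoc K x y ⟩
    K + (x + y)  ≡⟨ +-comm K (x + y) ⟩
    x + y + K    ≡⟨ d+e≡x+y+K ⟨
    d + e        <⟨ +-monoʳ-< d e<y ⟩
    d + y        ∎))
    where open ≤-Reasoning

shift-palindromic : ∀ {K g} → Palindromic K g → VanishesAbove K g →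
  ∀ x y {d e} → d + e ≡ (x + y) + K → shift x g d ≡ shift y g e
shift-palindromic {K} {g} g-pal g≡0 x y {d} {e} d+e≡ with x ≤? d | y ≤? e
... | yes x≤d | yes y≤e = cong₂ _*_ (trans ([≤]-yes x≤d) (sym ([≤]-yes y≤e)))
                                    (g-pal (d ∸ x) (e ∸ y) (∸-balanced d+e≡ x≤d y≤e))
... | yes x≤d | no  y≰e = trans ([≤]-null {x} {d} λ _ → g≡0 (d ∸ x) (∸-unbalanced d+e≡ x≤d (≰⇒> y≰e)))
                                (sym (cong (_* g (e ∸ y)) ([≤]-no (≰⇒> y≰e))))
... | no  x≰d | yes y≤e = trans (cong (_* g (d ∸ x)) ([≤]-no (≰⇒> x≰d)))
                                (sym ([≤]-null {y} {e} λ _ → g≡0 (e ∸ y) (∸-unbalanced e+d≡ y≤e (≰⇒> x≰d))))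
  where
  e+d≡ : e + d ≡ (y + x) + K
  e+d≡ = trans (+-comm e d) (trans d+e≡ (cong (_+ K) (+-comm x y)))
... | no  x≰d | no  y≰e = trans (cong (_* g (d ∸ x)) ([≤]-no (≰⇒> x≰d)))
                                (sym (cong (_* g (e ∸ y)) ([≤]-no (≰⇒> y≰e))))

-- boxCount ((a₁ , b₁) ∷ …) d is the number of x ∈ ∏ [aᵢ, bᵢ] with Σ xᵢ = d; the outer sum
-- runs up to a + b so that x ↦ a + b ∸ x reflects it.
boxCount : List (ℕ × ℕ) → ℕ → ℕ
boxCount []            zero    = 1
boxCount []            (suc _) = 0
boxCount ((a , b) ∷ r) d       = Σ≤ (a + b) (λ x → ⟦ a ≤ x ≤ b ⟧ * shift x (boxCount r) d)

boxDegree : List (ℕ × ℕ) → ℕ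
boxDegree []            = 0
boxDegree ((a , b) ∷ r) = a + b + boxDegree r

boxTop : List (ℕ × ℕ) → ℕ
boxTop []            = 0
boxTop ((a , b) ∷ r) = b + boxTop r

boxTop≤boxDegree : ∀ r → boxTop r ≤ boxDegree r
boxTop≤boxDegree []            = z≤n
boxTop≤boxDegree ((a , b) ∷ r) = begin
  b + boxTop r            ≤⟨ +-monoʳ-≤ b (boxTop≤boxDegree r) ⟩
  b + boxDegree r         ≤⟨ m≤n+m _ a ⟩
  a + (b + boxDegree r)   ≡⟨ +-assoc a b _ ⟨
  a + b + boxDegree r     ∎
  where open ≤-Reasoning

boxCount-vanishes : ∀ r → VanishesAbove (boxTop r) (boxCount r)
boxCount-vanishes []            (suc d) _        = refl
boxCount-vanishes ((a , b) ∷ r) d       b+top<d =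
  Σ≤-zero (a + b) λ x _ → ⟦≤≤⟧-null {a} {x} {b} λ _ x≤b →
    shift-vanishes x (boxCount-vanishes r) d (≤-<-trans (+-monoˡ-≤ (boxTop r) x≤b) b+top<d)

⟦≤≤⟧-reflect : ∀ {a b x} → x ≤ a + b → ⟦ a ≤ a + b ∸ x ≤ b ⟧ ≡ ⟦ a ≤ x ≤ b ⟧
⟦≤≤⟧-reflect {a} {b} {x} x≤a+b = trans (cong₂ _*_ lower upper) (*-comm [ x ≤ b ] [ a ≤ x ])
  where
  lower : [ a ≤ a + b ∸ x ] ≡ [ x ≤ b ]
  lower = [≤]-cong (λ a≤a+b∸x → +-cancelˡ-≤ a x b (m≤o∸n⇒m+n≤o a x≤a+b a≤a+b∸x))
                   (λ x≤b → m+n≤o⇒m≤o∸n a (+-monoʳ-≤ a x≤b))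
  upper : [ a + b ∸ x ≤ b ] ≡ [ a ≤ x ]
  upper = [≤]-cong (λ a+b∸x≤b → +-cancelʳ-≤ b a x (begin
                      a + b            ≡⟨ m∸n+n≡m x≤a+b ⟨
                      (a + b ∸ x) + x  ≤⟨ +-monoˡ-≤ x a+b∸x≤b ⟩
                      b + x            ≡⟨ +-comm b x ⟩
                      x + b            ∎))
                   (λ a≤x → m≤n+o⇒m∸n≤o (a + b) x (+-monoˡ-≤ b a≤x))
    where open ≤-Reasoning

boxCount-palindromic : ∀ r → Palindromic (boxDegree r) (boxCount r)
boxCount-palindromic []            zero    zero    _     = refl
boxCount-palindromic ((a , b) ∷ r) d       e       d+e≡ = begin
  Σ≤ (a + b) (summand d)                     ≡⟨ Σ≤-reverse (a + b) (summand d) ⟩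
  Σ≤ (a + b) (λ x → summand d (a + b ∸ x))   ≡⟨ Σ≤-cong (a + b) reflect ⟩
  Σ≤ (a + b) (summand e)                     ∎
  where
  open ≡-Reasoning
  summand : ℕ → ℕ → ℕ
  summand d x = ⟦ a ≤ x ≤ b ⟧ * shift x (boxCount r) d
  reflect : ∀ x → x ≤ a + b → summand d (a + b ∸ x) ≡ summand e x
  reflect x x≤a+b = cong₂ _*_ (⟦≤≤⟧-reflect {a} {b} x≤a+b)
    (shift-palindromic (boxCount-palindromic r)
                       (λ u top<u → boxCount-vanishes r u (≤-<-trans (boxTop≤boxDegree r) top<u))
                       (a + b ∸ x) x (trans d+e≡ (cong (_+ boxDegree r) (sym (m∸n+n≡m x≤a+b)))))

range : ℕ → List ℕ
range zero    = []
range (suc t) = range t ∷ʳ suc t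

range-bounds : ∀ t → All (λ j → 1 ≤ j × j ≤ t) (range t)
range-bounds zero    = []
range-bounds (suc t) =
  ∷ʳ⁺ (All.map (λ (1≤j , j≤t) → 1≤j , m≤n⇒m≤1+n j≤t) (range-bounds t)) (s≤s z≤n , ≤-refl)

sum-map-range : ∀ (φ : ℕ → ℕ) → φ 0 ≡ 0 → ∀ t → sum (map φ (range t)) ≡ Σ≤ t φ
sum-map-range φ φ0≡0 zero    = sym φ0≡0
sum-map-range φ φ0≡0 (suc t) = begin
  sum (map φ (range t ∷ʳ suc t))           ≡⟨ cong sum (map-++ φ (range t) _) ⟩
  sum (map φ (range t) ++ φ (suc t) ∷ [])  ≡⟨ sum-++ (map φ (range t)) _ ⟩
  sum (map φ (range t)) + (φ (suc t) + 0)  ≡⟨ cong₂ _+_ (sum-map-range φ φ0≡0 t) (+-identityʳ _) ⟩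
  Σ≤ t φ + φ (suc t)                       ∎
  where open ≡-Reasoning

range∘⊓-unique : {mn : ℕ → ℕ → ℕ} {r : ℕ → ℕ → List ℕ} →
  (∀ b → mn 0 b ≡ 0) → (∀ a → mn (suc a) 0 ≡ 0) → (∀ a b → mn (suc a) (suc b) ≡ suc (mn a b)) →
  (∀ b → r 0 b ≡ []) → (∀ a → r (suc a) 0 ≡ []) → (∀ a b → r (suc a) (suc b) ≡ r a b ∷ʳ suc (mn a b)) →
  ∀ a b → r a b ≡ range (a ⊓ b) × mn a b ≡ a ⊓ b
range∘⊓-unique mn₀ₗ mn₀ᵣ mnₛ r₀ₗ r₀ᵣ rₛ zero    b       = r₀ₗ b , mn₀ₗ b
range∘⊓-unique mn₀ₗ mn₀ᵣ mnₛ r₀ₗ r₀ᵣ rₛ (suc a) zero    = r₀ᵣ a , mn₀ᵣ a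
range∘⊓-unique mn₀ₗ mn₀ᵣ mnₛ r₀ₗ r₀ᵣ rₛ (suc a) (suc b) =
  let (r≡ , mn≡) = range∘⊓-unique mn₀ₗ mn₀ᵣ mnₛ r₀ₗ r₀ᵣ rₛ a b
  in trans (rₛ a b) (cong₂ (λ xs x → xs ∷ʳ suc x) r≡ mn≡) , trans (mnₛ a b) (cong suc mn≡)

-- The first parts are enumerated by helpers local to `partsLE`, which cannot be named; they are
-- identified through their defining equations.  Abstracting `suc n`, `suc k` and `_++_` keeps the
-- unification problems this creates in pattern form.
partsLE-suc : ∀ f n k →
  partsLE (suc f) (suc n) k ≡ concatMap (λ j → map (j ∷_) (partsLE f (suc n ∸ j) j)) (range (k ⊓ suc n))
partsLE-suc f n k with suc n | range∘⊓-unique (λ _ → refl) (λ _ → refl) (λ _ _ → refl)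
                                              (λ _ → refl) (λ _ → refl) (λ _ _ → refl)
partsLE-suc f n zero    | _     | _       = refl
partsLE-suc f n (suc k) | zero  | _       = refl
partsLE-suc f n (suc k) | suc y | unique with suc k | _++_ {A = ℕ}
... | _ | _++′_ = let (r≡ , mn≡) = unique k y in
  cong₂ (λ js j → concatMap _ (js ++′ (suc j ∷ []))) r≡ mn≡

partsLE-size : ∀ f d k → All (λ μ → size μ ≡ d) (partsLE f d k)
partsLE-size f       zero    k = refl ∷ []
partsLE-size zero    (suc d) k = []
partsLE-size (suc f) (suc d) k = subst (All _) (sym (partsLE-suc f d k))
  (concat⁺ (map⁺ (All.map prepend (range-bounds (k ⊓ suc d)))))
  where
  prepend : ∀ {j} → 1 ≤ j × j ≤ k ⊓ suc d →
    All (λ μ → size μ ≡ suc d) (map (j ∷_) (partsLE f (suc d ∸ j) j))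
  prepend {j} (_ , j≤k⊓1+d) = map⁺ (All.map
    (λ size≡ → trans (cong (j +_) size≡) (m+[n∸m]≡n (≤-trans j≤k⊓1+d (m⊓n≤n k (suc d)))))
    (partsLE-size f (suc d ∸ j) j))

-- Common horizontal strips

isPartition-tail : ∀ L → T (isPartition L) → T (isPartition (tail0 L))
isPartition-tail []       _ = tt
isPartition-tail (l ∷ ls) p = proj₂ (to (T-∧ {head0 ls ≤ᵇ l}) (proj₂ (to (T-∧ {1 ≤ᵇ l}) p)))

isPartition-[] : ∀ L → T (isPartition L) → head0 L ≤ 0 → L ≡ []
isPartition-[] []           _ _ = refl
isPartition-[] (zero ∷ ls)  p _  = ⊥-elim p
isPartition-[] (suc l ∷ ls) _ ()

hstrip-[] : ∀ L → T (isPartition L) → hstrip L [] ≡ (head0 (tail0 L) ≤ᵇ 0)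
hstrip-[] []                _ = refl
hstrip-[] (l ∷ [])          _ = refl
hstrip-[] (l ∷ zero ∷ ls)   p = ⊥-elim (isPartition-tail (l ∷ zero ∷ ls) p)
hstrip-[] (l ∷ suc l′ ∷ ls) _ = refl

hstrip-∷ : ∀ L j μ → hstrip L (suc j ∷ μ) ≡ (suc j ≤ᵇ head0 L) ∧ (head0 (tail0 L) ≤ᵇ suc j) ∧ hstrip (tail0 L) μ
hstrip-∷ []       j μ = refl
hstrip-∷ (l ∷ ls) j μ = refl

firstPartMin firstPartMax : List ℕ → List ℕ → ℕ
firstPartMin L V = head0 (tail0 L) ⊔ head0 (tail0 V)
firstPartMax L V = head0 L ⊓ head0 V

firstPartRange : List ℕ → List ℕ → ℕ × ℕ
firstPartRange L V = firstPartMin L V , firstPartMax L V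

-- Entry i is the range [max(λᵢ₊₁, νᵢ₊₁), min(λᵢ, νᵢ)] of the parts μᵢ for which λ/μ and ν/μ are
-- both horizontal strips.
intervals : List ℕ → List ℕ → List (ℕ × ℕ)
intervals []       []       = []
intervals []       (v ∷ vs) = firstPartRange [] (v ∷ vs) ∷ intervals [] vs
intervals (l ∷ ls) []       = firstPartRange (l ∷ ls) [] ∷ intervals ls []
intervals (l ∷ ls) (v ∷ vs) = firstPartRange (l ∷ ls) (v ∷ vs) ∷ intervals ls vs

boxCount-intervals : ∀ L V d →
  boxCount (intervals L V) d ≡ boxCount (firstPartRange L V ∷ intervals (tail0 L) (tail0 V)) d
boxCount-intervals []       []       zero    = refl
boxCount-intervals []       []       (suc d) = refl
boxCount-intervals []       (v ∷ vs) d       = refl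
boxCount-intervals (l ∷ ls) []       d       = refl
boxCount-intervals (l ∷ ls) (v ∷ vs) d       = refl

boxDegree-intervals-step : ∀ L V →
  boxDegree (intervals (tail0 L) (tail0 V)) + firstPartMin L V ≡ size (tail0 L) + size (tail0 V) →
  boxDegree (firstPartRange L V ∷ intervals (tail0 L) (tail0 V)) + (head0 L ⊔ head0 V)
    ≡ (head0 L + size (tail0 L)) + (head0 V + size (tail0 V))
boxDegree-intervals-step L V k+a≡s+t = begin
  (a + l ⊓ v + k) + (l ⊔ v)    ≡⟨ solve 4 (λ a b k M → ((a :+ b) :+ k) :+ M := (b :+ M) :+ (k :+ a))
                                        refl a (l ⊓ v) k (l ⊔ v) ⟩
  (l ⊓ v + (l ⊔ v)) + (k + a)  ≡⟨ cong₂ _+_ (m⊓n+m⊔n≡m+n l v) k+a≡s+t ⟩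
  (l + v) + (s + t)            ≡⟨ +-interchange l v s t ⟩
  (l + s) + (v + t)            ∎
  where
  open ≡-Reasoning
  l = head0 L
  v = head0 V
  s = size (tail0 L)
  t = size (tail0 V)
  a = firstPartMin L V
  k = boxDegree (intervals (tail0 L) (tail0 V))

boxDegree-intervals : ∀ L V → boxDegree (intervals L V) + (head0 L ⊔ head0 V) ≡ size L + size V
boxDegree-intervals []       []       = refl
boxDegree-intervals []       (v ∷ vs) = boxDegree-intervals-step [] (v ∷ vs) (boxDegree-intervals [] vs)
boxDegree-intervals (l ∷ ls) []       = boxDegree-intervals-step (l ∷ ls) [] (boxDegree-intervals ls [])
boxDegree-intervals (l ∷ ls) (v ∷ vs) =
  boxDegree-intervals-step (l ∷ ls) (v ∷ vs) (boxDegree-intervals ls vs)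

boxTop-intervals≤ˡ : ∀ L V → boxTop (intervals L V) ≤ size L
boxTop-intervals≤ˡ []       []       = z≤n
boxTop-intervals≤ˡ []       (v ∷ vs) = +-mono-≤ (m⊓n≤m 0 v) (boxTop-intervals≤ˡ [] vs)
boxTop-intervals≤ˡ (l ∷ ls) []       = +-mono-≤ (m⊓n≤m l 0) (boxTop-intervals≤ˡ ls [])
boxTop-intervals≤ˡ (l ∷ ls) (v ∷ vs) = +-mono-≤ (m⊓n≤m l v) (boxTop-intervals≤ˡ ls vs)

boxTop-intervals≤ʳ : ∀ L V → boxTop (intervals L V) ≤ size V
boxTop-intervals≤ʳ []       []       = z≤n
boxTop-intervals≤ʳ []       (v ∷ vs) = +-mono-≤ (m⊓n≤n 0 v) (boxTop-intervals≤ʳ [] vs)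
boxTop-intervals≤ʳ (l ∷ ls) []       = +-mono-≤ (m⊓n≤n l 0) (boxTop-intervals≤ʳ ls [])
boxTop-intervals≤ʳ (l ∷ ls) (v ∷ vs) = +-mono-≤ (m⊓n≤n l v) (boxTop-intervals≤ʳ ls vs)

intervals-tail-[] : ∀ L V → T (isPartition L) → T (isPartition V) → firstPartMin L V ≤ 0 →
  intervals (tail0 L) (tail0 V) ≡ []
intervals-tail-[] L V pL pV a≤0 = cong₂ intervals
  (isPartition-[] (tail0 L) (isPartition-tail L pL) (m⊔n≤o⇒m≤o _ _ a≤0))
  (isPartition-[] (tail0 V) (isPartition-tail V pV) (m⊔n≤o⇒n≤o _ _ a≤0))

strips : List ℕ → List ℕ → List ℕ → ℕ
strips L V μ = 𝟙 (hstrip L μ) * 𝟙 (hstrip V μ)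

strips-[] : ∀ L V → T (isPartition L) → T (isPartition V) → strips L V [] ≡ [ firstPartMin L V ≤ 0 ]
strips-[] L V pL pV = trans (cong₂ (λ x y → 𝟙 x * 𝟙 y) (hstrip-[] L pL) (hstrip-[] V pV))
                                (sym ([m⊔n≤o]≡[m≤o]*[n≤o] (head0 (tail0 L)) (head0 (tail0 V)) 0))

strips-∷ : ∀ L V j μ →
  strips L V (suc j ∷ μ) ≡ ⟦ firstPartMin L V ≤ suc j ≤ firstPartMax L V ⟧ * strips (tail0 L) (tail0 V) μ
strips-∷ L V j μ = begin
  𝟙 (hstrip L (suc j ∷ μ)) * 𝟙 (hstrip V (suc j ∷ μ))
    ≡⟨ cong₂ _*_ (trans (cong 𝟙 (hstrip-∷ L j μ)) (𝟙-∧³ l₁ l₂ l′))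
                 (trans (cong 𝟙 (hstrip-∷ V j μ)) (𝟙-∧³ v₁ v₂ v′)) ⟩
  (𝟙 l₁ * (𝟙 l₂ * 𝟙 l′)) * (𝟙 v₁ * (𝟙 v₂ * 𝟙 v′))
    ≡⟨ solve 6 (λ l₁ l₂ l′ v₁ v₂ v′ →
                  (l₁ :* (l₂ :* l′)) :* (v₁ :* (v₂ :* v′)) := ((l₂ :* v₂) :* (l₁ :* v₁)) :* (l′ :* v′))
               refl (𝟙 l₁) (𝟙 l₂) (𝟙 l′) (𝟙 v₁) (𝟙 v₂) (𝟙 v′) ⟩
  ((𝟙 l₂ * 𝟙 v₂) * (𝟙 l₁ * 𝟙 v₁)) * (𝟙 l′ * 𝟙 v′)
    ≡⟨ cong₂ (λ x y → x * y * strips (tail0 L) (tail0 V) μ)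
             (sym ([m⊔n≤o]≡[m≤o]*[n≤o] (head0 (tail0 L)) (head0 (tail0 V)) (suc j)))
             (sym ([m≤n⊓o]≡[m≤n]*[m≤o] (suc j) (head0 L) (head0 V))) ⟩
  ⟦ firstPartMin L V ≤ suc j ≤ firstPartMax L V ⟧ * strips (tail0 L) (tail0 V) μ ∎
  where
  open ≡-Reasoning
  l₁ = suc j ≤ᵇ head0 L
  l₂ = head0 (tail0 L) ≤ᵇ suc j
  l′ = hstrip (tail0 L) μ
  v₁ = suc j ≤ᵇ head0 V
  v₂ = head0 (tail0 V) ≤ᵇ suc j
  v′ = hstrip (tail0 V) μ
  𝟙-∧³ : ∀ x y z → 𝟙 (x ∧ y ∧ z) ≡ 𝟙 x * (𝟙 y * 𝟙 z)
  𝟙-∧³ x y z = trans (𝟙-∧ x (y ∧ z)) (cong (𝟙 x *_) (𝟙-∧ y z))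

stripCount : (fuel d k : ℕ) → List ℕ → List ℕ → ℕ
stripCount f d k L V = sum (map (strips L V) (partsLE f d k))

stripCount-suc : ∀ f d k L V → stripCount (suc f) (suc d) k L V ≡
  sum (map (λ x → sum (map (λ μ → strips L V (x ∷ μ)) (partsLE f (suc d ∸ x) x))) (range (k ⊓ suc d)))
stripCount-suc f d k L V = begin
  sum (map (strips L V) (partsLE (suc f) (suc d) k))
    ≡⟨ cong (λ P → sum (map (strips L V) P)) (partsLE-suc f d k) ⟩
  sum (map (strips L V) (concatMap (λ x → map (x ∷_) (P x)) xs))
    ≡⟨ sum-map-concatMap (strips L V) (λ x → map (x ∷_) (P x)) xs ⟩
  sum (map (λ x → sum (map (strips L V) (map (x ∷_) (P x)))) xs)
    ≡⟨ cong sum (map-cong (λ x → cong sum (map-∘ (P x))) xs) ⟨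
  sum (map (λ x → sum (map (λ μ → strips L V (x ∷ μ)) (P x))) xs) ∎
  where
  open ≡-Reasoning
  P : ℕ → List (List ℕ)
  P x = partsLE f (suc d ∸ x) x
  xs = range (k ⊓ suc d)

boxCount-intervals-0 : ∀ L V → T (isPartition L) → T (isPartition V) →
  boxCount (intervals L V) 0 ≡ [ firstPartMin L V ≤ 0 ]
boxCount-intervals-0 L V pL pV = begin
  boxCount (intervals L V) 0  ≡⟨ boxCount-intervals L V 0 ⟩
  Σ≤ (a + b) ψ                ≡⟨ Σ≤-extend {R′ = a + b} ψ z≤n (λ { (suc x) _ → *-zeroʳ ⟦ a ≤ suc x ≤ b ⟧ }) ⟩
  ψ 0                         ≡⟨ ⟦≤≤⟧-guard {a} {0} {b} (λ a≤0 _ → cong (λ r → shift 0 (boxCount r) 0)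
                                                                         (intervals-tail-[] L V pL pV a≤0)) ⟩
  [ a ≤ 0 ] * 1 * 1           ≡⟨ trans (*-identityʳ _) (*-identityʳ _) ⟩
  [ a ≤ 0 ]                   ∎
  where
  open ≡-Reasoning
  a = firstPartMin L V
  b = firstPartMax L V
  ψ : ℕ → ℕ
  ψ x = ⟦ a ≤ x ≤ b ⟧ * shift x (boxCount (intervals (tail0 L) (tail0 V))) 0

stripCount≡boxCount : ∀ f d k L V → T (isPartition L) → T (isPartition V) →
  (head0 L ⊓ head0 V) ⊓ d ≤ k → d ≤ f → stripCount f d k L V ≡ boxCount (intervals L V) d
stripCount≡boxCount f zero k L V pL pV _ _ =
  trans (+-identityʳ _) (trans (strips-[] L V pL pV) (sym (boxCount-intervals-0 L V pL pV)))
stripCount≡boxCount (suc f) (suc d) k L V pL pV b⊓d≤k d≤f = begin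
  stripCount (suc f) (suc d) k L V     ≡⟨ stripCount-suc f d k L V ⟩
  sum (map firstPartCount (range t))   ≡⟨ cong sum (map-cong-local (All.map firstPartCount≡ψ (range-bounds t))) ⟩
  sum (map ψ (range t))                ≡⟨ sum-map-range ψ ψ0≡0 t ⟩
  Σ≤ t ψ                               ≡⟨ Σ≤-support ψ ψ≡0ᵗ ψ≡0ᵃᵇ ⟩
  Σ≤ (a + b) ψ                         ≡⟨ boxCount-intervals L V (suc d) ⟨
  boxCount (intervals L V) (suc d)     ∎
  where
  open ≡-Reasoning
  a = firstPartMin L V
  b = firstPartMax L V
  t = k ⊓ suc d
  L′ = tail0 L
  V′ = tail0 V
  ψ : ℕ → ℕ
  ψ x = ⟦ a ≤ x ≤ b ⟧ * shift x (boxCount (intervals L′ V′)) (suc d)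
  firstPartCount : ℕ → ℕ
  firstPartCount x = sum (map (λ μ → strips L V (x ∷ μ)) (partsLE f (suc d ∸ x) x))
  firstPartCount≡ψ : ∀ {x} → 1 ≤ x × x ≤ t → firstPartCount x ≡ ψ x
  firstPartCount≡ψ {suc j} (_ , x≤t) = begin
    sum (map (λ μ → strips L V (suc j ∷ μ)) P)              ≡⟨ cong sum (map-cong (strips-∷ L V j) P) ⟩
    sum (map (λ μ → ⟦ a ≤ suc j ≤ b ⟧ * strips L′ V′ μ) P)  ≡⟨ sum-map-*ˡ ⟦ a ≤ suc j ≤ b ⟧ (strips L′ V′) P ⟩
    ⟦ a ≤ suc j ≤ b ⟧ * stripCount f (d ∸ j) (suc j) L′ V′  ≡⟨ ⟦≤≤⟧-guard {a} {suc j} {b} recurse ⟩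
    ψ (suc j)                                               ∎
    where
    P = partsLE f (d ∸ j) (suc j)
    g = boxCount (intervals L′ V′)
    recurse : a ≤ suc j → suc j ≤ b → stripCount f (d ∸ j) (suc j) L′ V′ ≡ shift (suc j) g (suc d)
    recurse a≤1+j _ = begin
      stripCount f (d ∸ j) (suc j) L′ V′
        ≡⟨ stripCount≡boxCount f (d ∸ j) (suc j) L′ V′ (isPartition-tail L pL) (isPartition-tail V pV)
             (≤-trans (m⊓n≤m _ (d ∸ j)) (≤-trans (m⊓n≤m⊔n (head0 L′) (head0 V′)) a≤1+j))
             (≤-trans (m∸n≤m d j) (≤-pred d≤f)) ⟩
      g (d ∸ j)                  ≡⟨ *-identityˡ (g (d ∸ j)) ⟨
      1 * g (d ∸ j)              ≡⟨ cong (_* g (d ∸ j)) ([≤]-yes {suc j} {suc d} (≤-trans x≤t (m⊓n≤n k (suc d)))) ⟨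
      shift (suc j) g (suc d)    ∎
  ψ0≡0 : ψ 0 ≡ 0
  ψ0≡0 = ⟦≤≤⟧-null {a} {0} {b} λ a≤0 _ →
    cong (λ r → shift 0 (boxCount r) (suc d)) (intervals-tail-[] L V pL pV a≤0)
  ψ≡0ᵗ : VanishesAbove t ψ
  ψ≡0ᵗ x t<x = ⟦≤≤⟧-null {a} {x} {b} λ _ x≤b → [≤]-null {x} {suc d} λ x≤1+d →
    ⊥-elim (<⇒≱ t<x (⊓-glb (≤-trans (⊓-glb x≤b x≤1+d) b⊓d≤k) x≤1+d))
  ψ≡0ᵃᵇ : VanishesAbove (a + b) ψ
  ψ≡0ᵃᵇ x a+b<x = ⟦≤≤⟧-null {a} {x} {b} λ _ x≤b → ⊥-elim (<⇒≱ a+b<x (≤-trans x≤b (m≤n+m b a)))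

isPartitionOf : ℕ → List ℕ → Bool
isPartitionOf n L = isPartition L ∧ (size L ≡ᵇ n)

isPartitionPair : ℕ → ℕ → List ℕ → List ℕ → Bool
isPartitionPair n m L V = isPartitionOf n L ∧ isPartitionOf m V

pieri-sized : ∀ {μ d n} L → size μ ≡ d → d ≤ n → pieri μ (n ∸ d) L ≡ 𝟙 (isPartitionOf n L) * 𝟙 (hstrip L μ)
pieri-sized {μ} {d} {n} L refl d≤n = begin
  𝟙 (isPartition L ∧ (size L ≡ᵇ size μ + (n ∸ size μ)) ∧ hstrip L μ)
    ≡⟨ cong (λ s → 𝟙 (isPartition L ∧ (size L ≡ᵇ s) ∧ hstrip L μ)) (m+[n∸m]≡n d≤n) ⟩
  𝟙 (isPartition L ∧ (size L ≡ᵇ n) ∧ hstrip L μ)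
    ≡⟨ cong 𝟙 (∧-assoc (isPartition L) (size L ≡ᵇ n) (hstrip L μ)) ⟨
  𝟙 (isPartitionOf n L ∧ hstrip L μ)
    ≡⟨ 𝟙-∧ (isPartitionOf n L) (hstrip L μ) ⟩
  𝟙 (isPartitionOf n L) * 𝟙 (hstrip L μ) ∎
  where open ≡-Reasoning

SF≡stripCount : ∀ {n m d} L V → d ≤ n → d ≤ m →
  SF n m d L V ≡ 𝟙 (isPartitionPair n m L V) * stripCount d d d L V
SF≡stripCount {n} {m} {d} L V d≤n d≤m = begin
  sum (map (λ μ → pieri μ (n ∸ d) L * pieri μ (m ∸ d) V) (partitions d))
    ≡⟨ cong sum (map-cong-local (All.map term (partsLE-size d d d))) ⟩
  sum (map (λ μ → valid * strips L V μ) (partitions d))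
    ≡⟨ sum-map-*ˡ valid (strips L V) (partitions d) ⟩
  valid * stripCount d d d L V
    ≡⟨ cong (_* stripCount d d d L V) (𝟙-∧ (isPartitionOf n L) (isPartitionOf m V)) ⟨
  𝟙 (isPartitionPair n m L V) * stripCount d d d L V ∎
  where
  open ≡-Reasoning
  valid = 𝟙 (isPartitionOf n L) * 𝟙 (isPartitionOf m V)
  term : ∀ {μ} → size μ ≡ d → pieri μ (n ∸ d) L * pieri μ (m ∸ d) V ≡ valid * strips L V μ
  term {μ} size≡d = trans (cong₂ _*_ (pieri-sized L size≡d d≤n) (pieri-sized V size≡d d≤m))
                          (*-interchange (𝟙 (isPartitionOf n L)) (𝟙 (hstrip L μ)) (𝟙 (isPartitionOf m V)) _)

trunc≡[⊔≤]* : ∀ X (F : Λ⊗Λ) λ′ ν → trunc X F λ′ ν ≡ [ head0 λ′ ⊔ head0 ν ≤ X ] * F λ′ ν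
trunc≡[⊔≤]* X F λ′ ν = begin
  (if (head0 λ′ ≤ᵇ X) ∧ (head0 ν ≤ᵇ X) then F λ′ ν else 0)
    ≡⟨ if-then-0≡𝟙* ((head0 λ′ ≤ᵇ X) ∧ (head0 ν ≤ᵇ X)) (F λ′ ν) ⟩
  𝟙 ((head0 λ′ ≤ᵇ X) ∧ (head0 ν ≤ᵇ X)) * F λ′ ν
    ≡⟨ cong (_* F λ′ ν) (𝟙-∧ (head0 λ′ ≤ᵇ X) (head0 ν ≤ᵇ X)) ⟩
  [ head0 λ′ ≤ X ] * [ head0 ν ≤ X ] * F λ′ ν
    ≡⟨ cong (_* F λ′ ν) ([m⊔n≤o]≡[m≤o]*[n≤o] (head0 λ′) (head0 ν) X) ⟨
  [ head0 λ′ ⊔ head0 ν ≤ X ] * F λ′ ν ∎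
  where open ≡-Reasoning

sumTo-trunc : ∀ N (X : ℕ → ℕ) (F : ℕ → Λ⊗Λ) λ′ ν →
  sumTo N (λ d → trunc (X d) (F d)) λ′ ν ≡ Σ≤ N (λ d → [ head0 λ′ ⊔ head0 ν ≤ X d ] * F d λ′ ν)
sumTo-trunc N X F λ′ ν = trans (sumTo-apply N _ λ′ ν) (Σ≤-cong N λ d _ → trunc≡[⊔≤]* (X d) (F d) λ′ ν)

isPartitionOf-sound : ∀ n L → T (isPartitionOf n L) → T (isPartition L) × size L ≡ n
isPartitionOf-sound n L valid =
  let (pL , sL) = to (T-∧ {isPartition L}) valid in pL , ≡ᵇ⇒≡ (size L) n sL

isPartitionPair-sound : ∀ n m L V → T (isPartitionPair n m L V) →
  (T (isPartition L) × size L ≡ n) × (T (isPartition V) × size V ≡ m)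
isPartitionPair-sound n m L V valid =
  let (validL , validV) = to (T-∧ {isPartitionOf n L}) valid
  in isPartitionOf-sound n L validL , isPartitionOf-sound m V validV

module _ {n m d : ℕ} (L V : List ℕ) (d≤n : d ≤ n) (d≤m : d ≤ m) where

  SF≡boxCount : T (isPartitionPair n m L V) → SF n m d L V ≡ boxCount (intervals L V) d
  SF≡boxCount valid with isPartitionPair-sound n m L V valid
  ... | (pL , _) , (pV , _) = begin
    SF n m d L V                                   ≡⟨ SF≡stripCount L V d≤n d≤m ⟩
    𝟙 (isPartitionPair n m L V) * stripCount d d d L V ≡⟨ cong (_* stripCount d d d L V) (𝟙-T valid) ⟩
    1 * stripCount d d d L V                       ≡⟨ *-identityˡ _ ⟩
    stripCount d d d L V                           ≡⟨ stripCount≡boxCount d d d L V pL pV (m⊓n≤n _ d) ≤-refl ⟩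
    boxCount (intervals L V) d                     ∎
    where open ≡-Reasoning

  SF-invalid : ¬ T (isPartitionPair n m L V) → SF n m d L V ≡ 0
  SF-invalid invalid = trans (SF≡stripCount L V d≤n d≤m) (cong (_* stripCount d d d L V) (𝟙-¬T invalid))

truncatedSum-SF : ∀ {n m} → 1 ≤ n → 1 ≤ m → ∀ L V →
  truncatedSum (n + m) (head0 L ⊔ head0 V) (n ⊓ m) (λ d → SF n m d L V) ≡ Σ≤ (n ⊓ m) (λ d → SF n m d L V)
truncatedSum-SF {n} {m} 1≤n 1≤m L V = by-validity (T? (isPartitionPair n m L V))
  where
  open ≡-Reasoning
  M = head0 L ⊔ head0 V
  N = n ⊓ m
  I = intervals L V
  d≤n : ∀ {d} → d ≤ N → d ≤ n
  d≤n d≤N = ≤-trans d≤N (m⊓n≤m n m)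
  d≤m : ∀ {d} → d ≤ N → d ≤ m
  d≤m d≤N = ≤-trans d≤N (m⊓n≤n n m)
  by-validity : Dec (T (isPartitionPair n m L V)) →
    truncatedSum (n + m) M N (λ d → SF n m d L V) ≡ Σ≤ N (λ d → SF n m d L V)
  by-validity (no invalid) =
    truncatedSum-null (n + m) M N λ d d≤N → SF-invalid L V (d≤n d≤N) (d≤m d≤N) invalid
  by-validity (yes valid) with isPartitionPair-sound n m L V valid
  ... | (_ , sL) , (_ , sV) = begin
    truncatedSum (n + m) M N (λ d → SF n m d L V)
      ≡⟨ truncatedSum-cong (n + m) M N SF≡f ⟩
    truncatedSum (n + m) M N (boxCount I)
      ≡⟨ truncatedSum-palindromic (⊓-glb 1≤n 1≤m) 2N≤n+m K+M≡n+m (boxCount-palindromic I)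
           (VanishesAbove-mono top≤N (boxCount-vanishes I))
           (VanishesAbove-mono (boxTop≤boxDegree I) (boxCount-vanishes I)) ⟩
    Σ≤ N (boxCount I)
      ≡⟨ Σ≤-cong N (λ d d≤N → sym (SF≡f d d≤N)) ⟩
    Σ≤ N (λ d → SF n m d L V) ∎
    where
    SF≡f : ∀ d → d ≤ N → SF n m d L V ≡ boxCount I d
    SF≡f d d≤N = SF≡boxCount L V (d≤n d≤N) (d≤m d≤N) valid
    K+M≡n+m : boxDegree I + M ≡ n + m
    K+M≡n+m = trans (boxDegree-intervals L V) (cong₂ _+_ sL sV)
    top≤N : boxTop I ≤ N
    top≤N = ⊓-glb (subst (boxTop I ≤_) sL (boxTop-intervals≤ˡ L V))
                  (subst (boxTop I ≤_) sV (boxTop-intervals≤ʳ L V))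
    2N≤n+m : 2 * N ≤ n + m
    2N≤n+m = +-mono-≤ (m⊓n≤m n m) (subst (_≤ m) (sym (+-identityʳ N)) (m⊓n≤n n m))

corollary3p4 : (n m : ℕ) → 1 ≤ n → 1 ≤ m → (λ' ν : List ℕ) →
    ((sumTo (n ⊓ m) (λ d → trunc (n + m ∸ 2 * d) (SF n m d))
      ⊕ sumTo (n ⊓ m ∸ 1) (λ d → trunc (n + m ∸ 2 * d ∸ 1) (SF n m d))) λ' ν)
    ≡ sumTo (n ⊓ m) (λ r → SF n m r) λ' ν
corollary3p4 n m 1≤n 1≤m λ′ ν = begin
  sumTo (n ⊓ m) (λ d → trunc (n + m ∸ 2 * d) (SF n m d)) λ′ ν
    + sumTo (n ⊓ m ∸ 1) (λ d → trunc (n + m ∸ 2 * d ∸ 1) (SF n m d)) λ′ ν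
      ≡⟨ cong₂ _+_ (sumTo-trunc (n ⊓ m) _ (SF n m) λ′ ν) (sumTo-trunc (n ⊓ m ∸ 1) _ (SF n m) λ′ ν) ⟩
  truncatedSum (n + m) (head0 λ′ ⊔ head0 ν) (n ⊓ m) (λ d → SF n m d λ′ ν)
      ≡⟨ truncatedSum-SF 1≤n 1≤m λ′ ν ⟩
  Σ≤ (n ⊓ m) (λ d → SF n m d λ′ ν)
      ≡⟨ sumTo-apply (n ⊓ m) (SF n m) λ′ ν ⟨
  sumTo (n ⊓ m) (λ r → SF n m r) λ′ ν ∎
  where open ≡-Reasoning
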